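{- For every integer $n\ge 3$, $\tilde{R}(\dot A_2^{(b)}\sqcup \dot A_2^{(r)},Q_n)=n+2$.
   Context: $Q_N$ denotes the Boolean lattice of all subsets of an $N$-element set ordered by inclusion. An (induced) copy of a poset $P$ in a poset $Q$ is a subset of $Q$ which, with the inherited order, is isomorphic to $P$. A colored poset $\dot P$ is a poset with a coloring of its elements in blue and red; a copy of $\dot P$ in a colored $Q$ is an induced copy of $P$ whose vertices have the same colors as the corresponding vertices of $\dot P$. $A_2$ is the antichain on two vertices; $\dot A_2^{(b)}$ and $\dot A_2^{(r)}$ are $A_2$ colored all blue, resp. all red. $\dot P_1\sqcup\dot P_2$ denotes the colored poset consisting of disjoint copies of $\dot P_1$ and $\dot P_2$ in which every vertex of one is incomparable to every vertex of the other (so $\dot A_2^{(b)}\sqcup \dot A_2^{(r)}$ is an antichain of four vertices, two blue and two red). $\dot Q_n^{(b)}$ (resp. $\dot Q_n^{(r)}$) is $Q_n$ colored entirely blue (resp. red). $\tilde{R}(\dot P,Q_n)$ is the minimum $N$ such that every blue/red coloring of $Q_N$ contains a copy of $\dot P$, of $\dot Q_n^{(b)}$, or of $\dot Q_n^{(r)}$. -}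

module Defs where

open import Data.Nat using (ℕ; _<_)
open import Data.Fin.Subset using (Subset; _⊆_)
open import Data.Product using (Σ; _×_; ∃)
open import Data.Sum using (_⊎_)
open import Relation.Binary.PropositionalEquality using (_≡_)
open import Relation.Nullary using (¬_)
open import Function.Bundles using (_⇔_)

-- Q_N : the Boolean lattice of subsets of Fin N, ordered by ⊆.

data Color : Set where
  blue red : Color

Coloring : ℕ → Set
Coloring N = Subset N → Color

-- an induced copy of Q_n in Q_N : an order embedding
-- (x ⊆ y iff f x ⊆ f y); its image is an induced copy of Q_n.
record QnCopy (n N : ℕ) : Set where
  field
    emb    : Subset n → Subset N
    orderIff : ∀ x y → (x ⊆ y) ⇔ (emb x ⊆ emb y)

MonoCopy : ∀ {N} → Coloring N → Color → (n : ℕ) → Set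
MonoCopy {N} c k n = Σ (QnCopy n N) λ q → ∀ x → c (QnCopy.emb q x) ≡ k

Incomparable : ∀ {N} → Subset N → Subset N → Set
Incomparable x y = ¬ (x ⊆ y) × ¬ (y ⊆ x)

-- a copy of  Ȧ₂^(b) ⊔ Ȧ₂^(r) : four pairwise incomparable elements,
-- b₁ b₂ blue and r₁ r₂ red
record A2bA2rCopy {N : ℕ} (c : Coloring N) : Set where
  field
    b₁ b₂ r₁ r₂ : Subset N
    inc-b₁b₂ : Incomparable b₁ b₂
    inc-r₁r₂ : Incomparable r₁ r₂
    inc-b₁r₁ : Incomparable b₁ r₁
    inc-b₁r₂ : Incomparable b₁ r₂
    inc-b₂r₁ : Incomparable b₂ r₁
    inc-b₂r₂ : Incomparable b₂ r₂
    col-b₁ : c b₁ ≡ blue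
    col-b₂ : c b₂ ≡ blue
    col-r₁ : c r₁ ≡ red
    col-r₂ : c r₂ ≡ red

RamseyProp : ℕ → ℕ → Set
RamseyProp n N = (c : Coloring N) →
  A2bA2rCopy c ⊎ (MonoCopy c blue n ⊎ MonoCopy c red n)

-- R̃(Ȧ₂^(b) ⊔ Ȧ₂^(r), Q_n) = m : m is the least N with RamseyProp n N
RtildeEq : ℕ → ℕ → Set
RtildeEq n m = RamseyProp n m × (∀ N → N < m → ¬ RamseyProp n N)

-- Lower bound: colour ⊥ and ⊤ of Q_{n+1} red and everything else blue. Red
-- elements are comparable to everything, so there is no red antichain, and for
-- n ≥ 2 no red Q_n; a copy of Q_n climbs at least n ranks while blue elements
-- have rank between 1 and n, so there is no blue Q_n either.
--
-- Upper bound: write Q_{n+2} = Q_2 × Q_n. The layers 10 × Q_n and 01 × Q_n are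
-- copies of Q_n, and every element of one is incomparable to every element of
-- the other. Call x ∈ Q_n mixed when its first three coordinates are not all
-- equal; rotating those coordinates puts a mixed y into a 3-antichain of mixed
-- elements. If neither layer is monochromatic on its mixed part, each contains
-- an incomparable blue/red pair and these four points are the antichain.
-- Otherwise, up to exchanging the first two coordinates, layer 10 has constant
-- colour k on mixed points. Unless a layer is entirely k, both layers have a
-- point of the opposite colour k̄; a mixed k̄ point of layer 01 with its two
-- partners gives the antichain, and if there is none both layers are k on mixed
-- points. Then the copy x ↦ (x₀, x₁, 1, 0, x₂, …) of Q_n, which meets layers 10
-- and 01 in mixed points only, is monochromatic unless one of its points in
-- layer 00 or 11 has colour k̄, and a case analysis on that point and the two k̄
-- points of layers 10 and 01 produces the antichain.

module Submission where

open import Defs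
open import Data.Nat using (ℕ; zero; suc; _≤_; _<_; _+_; s≤s; z≤n)
open import Data.Nat.Properties
  using (≤-reflexive; <⇒≱; ≤∧≢⇒<; +-monoˡ-≤; +-suc; +-identityʳ; +-comm; module ≤-Reasoning)
open import Data.Bool as Bool using (Bool; true; false; b≤b; f≤t)
open import Data.Empty using () renaming (⊥ to Empty)
open import Data.Unit using () renaming (⊤ to Unit)
open import Data.Vec using ([]; _∷_)
open import Data.Vec.Base using (here; there)
open import Data.Vec.Properties using (≡-dec)
import Data.Fin as Fin
open import Data.Fin.Subset using (Subset; _⊆_; ⊥; ⊤; ∣_∣; ⁅_⁆)
open import Data.Fin.Subset.Properties
  using ( _⊆?_; anySubset?; drop-∷-⊆; s⊆s; out⊆; ⊥⊆; ⊆⊤; ∉⊥; x∈⁅x⁆; x∈⁅y⁆⇒x≡y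
        ; p⊆q⇒∣p∣≤∣q∣; ∣p∣≤n; ∣p∣≡n⇒p≡⊤ )
open import Data.Product using (∃; ∃₂; _×_; _,_; proj₁; proj₂; swap)
open import Data.Sum using (_⊎_; inj₁; inj₂; [_,_])
open import Function using (_∘_; _⇔_; mk⇔; Equivalence)
open import Function.Construct.Composition using (_⇔-∘_)
open import Relation.Binary.PropositionalEquality using (_≡_; _≢_; refl; sym; trans; cong; subst)
open import Relation.Nullary using (¬_; Dec; yes; no; contradiction)
open import Relation.Nullary.Decidable using (False; toWitnessFalse; decidable-stable; ¬?; _×-dec_)
open import Relation.Unary using (Pred; Decidable)

private
  variable
    n m N M : ℕ

opposite : Color → Color
opposite blue = red
opposite red  = blue

_≟ᶜ_ : (a b : Color) → Dec (a ≡ b)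
blue ≟ᶜ blue = yes refl
blue ≟ᶜ red  = no λ ()
red  ≟ᶜ blue = no λ ()
red  ≟ᶜ red  = yes refl

≢⇒≡opposite : ∀ {a k} → a ≢ k → a ≡ opposite k
≢⇒≡opposite {blue} {blue} a≢k = contradiction refl a≢k
≢⇒≡opposite {blue} {red}  _   = refl
≢⇒≡opposite {red}  {blue} _   = refl
≢⇒≡opposite {red}  {red}  a≢k = contradiction refl a≢k

all-or-counterexample : ∀ {ℓ} {P : Pred (Subset n) ℓ} →
                        Decidable P → (∀ x → P x) ⊎ ∃ λ x → ¬ P x
all-or-counterexample P? with anySubset? (¬? ∘ P?)
... | yes counterexample = inj₂ counterexample
... | no  none           = inj₁ λ x → decidable-stable (P? x) λ ¬Px → none (x , ¬Px)

all-or-counterexample-in : ∀ {ℓ ℓ′} {A : Pred (Subset n) ℓ} {P : Pred (Subset n) ℓ′} →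
                           Decidable A → Decidable P → (∀ x → A x → P x) ⊎ ∃ λ x → A x × ¬ P x
all-or-counterexample-in A? P? with anySubset? (λ x → A? x ×-dec ¬? (P? x))
... | yes counterexample = inj₂ counterexample
... | no  none           = inj₁ λ x Ax → decidable-stable (P? x) λ ¬Px → none (x , Ax , ¬Px)

-- The implicit proof is found by evaluation, which succeeds once x and y are
-- known up to a coordinate at which x has an element that y lacks.
decide-⊈ : {x y : Subset n} {x⊈y : False (x ⊆? y)} → ¬ x ⊆ y
decide-⊈ {x⊈y = x⊈y} = toWitnessFalse x⊈y

decide-∥ : {x y : Subset n} {x⊈y : False (x ⊆? y)} {y⊈x : False (y ⊆? x)} → Incomparable x y
decide-∥ {x⊈y = x⊈y} {y⊈x} = toWitnessFalse x⊈y , toWitnessFalse y⊈x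

∷⊈∷ : ∀ {s t} {x y : Subset n} → ¬ x ⊆ y → ¬ (s ∷ x) ⊆ (t ∷ y)
∷⊈∷ {s = s} {t} x⊈y h = x⊈y (drop-∷-⊆ {s = s} {t = t} h)

∷∷-∥ : ∀ {a b a′ b′} {x y : Subset n} → Incomparable x y → Incomparable (a ∷ b ∷ x) (a′ ∷ b′ ∷ y)
∷∷-∥ (x⊈y , y⊈x) = ∷⊈∷ (∷⊈∷ x⊈y) , ∷⊈∷ (∷⊈∷ y⊈x)

head-≤ : ∀ {s t} {x y : Subset n} → (s ∷ x) ⊆ (t ∷ y) → s Bool.≤ t
head-≤ {s = false} {t = false} _ = b≤b
head-≤ {s = false} {t = true}  _ = f≤t
head-≤ {s = true}  {t = true}  _ = b≤b
head-≤ {s = true}  {t = false} h with h here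
... | ()

∷⊆∷-⇔ : ∀ {s t} {x y : Subset n} → ((s ∷ x) ⊆ (t ∷ y)) ⇔ (s Bool.≤ t × x ⊆ y)
∷⊆∷-⇔ {s = s} {t} {x} {y} = mk⇔ split join
  where
    split : (s ∷ x) ⊆ (t ∷ y) → s Bool.≤ t × x ⊆ y
    split h = head-≤ h , drop-∷-⊆ h
    join : s Bool.≤ t × x ⊆ y → (s ∷ x) ⊆ (t ∷ y)
    join (b≤b , x⊆y) = s⊆s x⊆y
    join (f≤t , x⊆y) = out⊆ x⊆y

∷⊆∷-tail : ∀ {s t} {x y : Subset n} {x′ y′ : Subset m} →
            (x ⊆ y → x′ ⊆ y′) → (s ∷ x) ⊆ (t ∷ y) → (s ∷ x′) ⊆ (t ∷ y′)
∷⊆∷-tail f sx⊆ty = let s≤t , x⊆y = Equivalence.to ∷⊆∷-⇔ sx⊆ty in Equivalence.from ∷⊆∷-⇔ (s≤t , f x⊆y)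

⊆∧⊉⇒∣p∣<∣q∣ : (p q : Subset n) → p ⊆ q → ¬ q ⊆ p → ∣ p ∣ < ∣ q ∣
⊆∧⊉⇒∣p∣<∣q∣ []          []          _   q⊈p = contradiction (λ {_} x∈q → x∈q) q⊈p
⊆∧⊉⇒∣p∣<∣q∣ (false ∷ p) (false ∷ q) p⊆q q⊈p = ⊆∧⊉⇒∣p∣<∣q∣ p q (drop-∷-⊆ p⊆q) (λ h → q⊈p (s⊆s h))
⊆∧⊉⇒∣p∣<∣q∣ (false ∷ p) (true ∷ q)  p⊆q _   = s≤s (p⊆q⇒∣p∣≤∣q∣ (drop-∷-⊆ p⊆q))
⊆∧⊉⇒∣p∣<∣q∣ (true ∷ p)  (false ∷ q) p⊆q _   with p⊆q here
... | ()
⊆∧⊉⇒∣p∣<∣q∣ (true ∷ p)  (true ∷ q)  p⊆q q⊈p = s≤s (⊆∧⊉⇒∣p∣<∣q∣ p q (drop-∷-⊆ p⊆q) (λ h → q⊈p (s⊆s h)))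

∣p∣≡0⇒p≡⊥ : (p : Subset n) → ∣ p ∣ ≡ 0 → p ≡ ⊥
∣p∣≡0⇒p≡⊥ []          _     = refl
∣p∣≡0⇒p≡⊥ (false ∷ p) ∣p∣≡0 = cong (false ∷_) (∣p∣≡0⇒p≡⊥ p ∣p∣≡0)

emb-∥ : (e : QnCopy n N) {x y : Subset n} → let open QnCopy e in
        Incomparable x y → Incomparable (emb x) (emb y)
emb-∥ e (x⊈y , y⊈x) = x⊈y ∘ from (orderIff _ _) , y⊈x ∘ from (orderIff _ _)
  where open QnCopy e
        open Equivalence

_∘ᶜ_ : QnCopy m N → QnCopy n m → QnCopy n N
e ∘ᶜ f = record
  { emb      = QnCopy.emb e ∘ QnCopy.emb f
  ; orderIff = λ x y → QnCopy.orderIff e _ _ ⇔-∘ QnCopy.orderIff f x y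
  }

prepend : Bool → QnCopy n (suc n)
prepend s = record { emb = s ∷_ ; orderIff = λ _ _ → mk⇔ s⊆s drop-∷-⊆ }

layer : Bool → Bool → QnCopy n (2 + n)
layer a b = prepend a ∘ᶜ prepend b

on-tail : QnCopy n N → QnCopy (suc n) (suc N)
on-tail e = record
  { emb      = λ { (s ∷ x) → s ∷ emb x }
  ; orderIff = λ { (s ∷ x) (t ∷ y) →
      mk⇔ (∷⊆∷-tail (to (orderIff x y))) (∷⊆∷-tail (from (orderIff x y))) }
  }
  where open QnCopy e
        open Equivalence

exchange : Subset (2 + n) → Subset (2 + n)
exchange (a ∷ b ∷ x) = b ∷ a ∷ x

exchange-⊆ : (x y : Subset (2 + n)) → x ⊆ y → exchange x ⊆ exchange y
exchange-⊆ (a ∷ b ∷ x) (a′ ∷ b′ ∷ y) ab⊆ =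
  let a≤a′ , b⊆ = Equivalence.to ∷⊆∷-⇔ ab⊆
      b≤b′ , x⊆y = Equivalence.to ∷⊆∷-⇔ b⊆
  in Equivalence.from ∷⊆∷-⇔ (b≤b′ , Equivalence.from ∷⊆∷-⇔ (a≤a′ , x⊆y))

exchange-copy : QnCopy (2 + n) (2 + n)
exchange-copy = record
  { emb      = exchange
  ; orderIff = λ { x@(_ ∷ _ ∷ _) y@(_ ∷ _ ∷ _) →
      mk⇔ (exchange-⊆ x y) (exchange-⊆ (exchange x) (exchange y)) }
  }

RamseyWitness : Coloring N → ℕ → Set
RamseyWitness c n = A2bA2rCopy c ⊎ (MonoCopy c blue n ⊎ MonoCopy c red n)

mono-witness : {c : Coloring N} (k : Color) → MonoCopy c k n → RamseyWitness c n
mono-witness blue copy = inj₂ (inj₁ copy)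
mono-witness red  copy = inj₂ (inj₂ copy)

pull-back : (e : QnCopy N M) {c : Coloring M} →
            RamseyWitness (c ∘ QnCopy.emb e) n → RamseyWitness c n
pull-back e (inj₁ P) = inj₁ record
  { b₁ = emb b₁ ; b₂ = emb b₂ ; r₁ = emb r₁ ; r₂ = emb r₂
  ; inc-b₁b₂ = emb-∥ e inc-b₁b₂ ; inc-r₁r₂ = emb-∥ e inc-r₁r₂
  ; inc-b₁r₁ = emb-∥ e inc-b₁r₁ ; inc-b₁r₂ = emb-∥ e inc-b₁r₂
  ; inc-b₂r₁ = emb-∥ e inc-b₂r₁ ; inc-b₂r₂ = emb-∥ e inc-b₂r₂
  ; col-b₁ = col-b₁ ; col-b₂ = col-b₂ ; col-r₁ = col-r₁ ; col-r₂ = col-r₂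
  }
  where open A2bA2rCopy P
        open QnCopy e
pull-back e (inj₂ (inj₁ (q , mono))) = inj₂ (inj₁ (e ∘ᶜ q , mono))
pull-back e (inj₂ (inj₂ (q , mono))) = inj₂ (inj₂ (e ∘ᶜ q , mono))

two-coloured-antichain : {c : Coloring N} (k : Color) {p q u v : Subset N} →
  c p ≡ opposite k → c q ≡ opposite k → c u ≡ k → c v ≡ k →
  Incomparable p q → Incomparable u v →
  Incomparable p u → Incomparable p v → Incomparable q u → Incomparable q v →
  A2bA2rCopy c
two-coloured-antichain blue cp cq cu cv p∥q u∥v p∥u p∥v q∥u q∥v = record
  { b₁ = _ ; b₂ = _ ; r₁ = _ ; r₂ = _
  ; inc-b₁b₂ = u∥v ; inc-r₁r₂ = p∥q
  ; inc-b₁r₁ = swap p∥u ; inc-b₁r₂ = swap q∥u ; inc-b₂r₁ = swap p∥v ; inc-b₂r₂ = swap q∥v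
  ; col-b₁ = cu ; col-b₂ = cv ; col-r₁ = cp ; col-r₂ = cq
  }
two-coloured-antichain red cp cq cu cv p∥q u∥v p∥u p∥v q∥u q∥v = record
  { b₁ = _ ; b₂ = _ ; r₁ = _ ; r₂ = _
  ; inc-b₁b₂ = p∥q ; inc-r₁r₂ = u∥v
  ; inc-b₁r₁ = p∥u ; inc-b₁r₂ = p∥v ; inc-b₂r₁ = q∥u ; inc-b₂r₂ = q∥v
  ; col-b₁ = cp ; col-b₂ = cq ; col-r₁ = cu ; col-r₂ = cv
  }

-- Lower bound

rank-gap : (e : QnCopy n N) → ∣ QnCopy.emb e ⊥ ∣ + n ≤ ∣ QnCopy.emb e ⊤ ∣
rank-gap {n = zero}  e = ≤-reflexive (+-identityʳ _)
rank-gap {n = suc n} e = begin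
  ∣ emb ⊥ ∣ + suc n           ≡⟨ +-suc _ n ⟩
  suc (∣ emb ⊥ ∣ + n)         ≤⟨ s≤s (rank-gap (e ∘ᶜ prepend false)) ⟩
  suc ∣ emb (false ∷ ⊤) ∣     ≤⟨ below-top ⟩
  ∣ emb ⊤ ∣                   ∎
  where
    open ≤-Reasoning
    open QnCopy e
    open Equivalence
    top⊈ : ¬ ⊤ ⊆ (false ∷ ⊤)
    top⊈ h with h here
    ... | ()
    below-top : ∣ emb (false ∷ ⊤) ∣ < ∣ emb ⊤ ∣
    below-top = ⊆∧⊉⇒∣p∣<∣q∣ _ _ (to (orderIff _ ⊤) ⊆⊤) (top⊈ ∘ from (orderIff ⊤ _))

extremes-red : Coloring N
extremes-red x with ≡-dec Bool._≟_ x ⊥ | ≡-dec Bool._≟_ x ⊤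
... | no _ | no _ = blue
... | _    | _    = red

red⇒extreme : (x : Subset N) → extremes-red x ≡ red → x ≡ ⊥ ⊎ x ≡ ⊤
red⇒extreme x _ with ≡-dec Bool._≟_ x ⊥ | ≡-dec Bool._≟_ x ⊤
red⇒extreme x () | no _     | no _
... | yes x≡⊥ | _       = inj₁ x≡⊥
... | no _    | yes x≡⊤ = inj₂ x≡⊤

blue⇒non-extreme : (x : Subset N) → extremes-red x ≡ blue → x ≢ ⊥ × x ≢ ⊤
blue⇒non-extreme x _ with ≡-dec Bool._≟_ x ⊥ | ≡-dec Bool._≟_ x ⊤
blue⇒non-extreme x () | yes _ | _
blue⇒non-extreme x () | no _  | yes _
... | no x≢⊥ | no x≢⊤ = x≢⊥ , x≢⊤

extreme⇒comparable : ∀ {x y : Subset N} → x ≡ ⊥ ⊎ x ≡ ⊤ → ¬ Incomparable x y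
extreme⇒comparable (inj₁ refl) (x⊈y , _) = x⊈y ⊥⊆
extreme⇒comparable (inj₂ refl) (_ , y⊈x) = y⊈x ⊆⊤

no-two-coloured-antichain : ¬ A2bA2rCopy (extremes-red {N})
no-two-coloured-antichain P = extreme⇒comparable (red⇒extreme r₁ col-r₁) inc-r₁r₂
  where open A2bA2rCopy P

no-red-copy : ¬ MonoCopy (extremes-red {N}) red (2 + n)
no-red-copy {n = n} (q , mono) = [ not-bottom , not-top ] (red⇒extreme (emb atom) (mono atom))
  where
    open QnCopy q
    open Equivalence
    atom : Subset (2 + n)
    atom = ⁅ Fin.zero ⁆
    not-bottom : emb atom ≢ ⊥
    not-bottom atom↦⊥ = ∉⊥ (from (orderIff atom ⊥) (subst (_⊆ emb ⊥) (sym atom↦⊥) ⊥⊆) (x∈⁅x⁆ Fin.zero))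
    not-top : emb atom ≢ ⊤
    not-top atom↦⊤ with x∈⁅y⁆⇒x≡y Fin.zero (from (orderIff ⊤ atom) (subst (emb ⊤ ⊆_) (sym atom↦⊤) ⊆⊤) (there here))
    ... | ()

blue⇒0<∣x∣<N : (x : Subset N) → extremes-red x ≡ blue → 0 < ∣ x ∣ × ∣ x ∣ < N
blue⇒0<∣x∣<N x x-blue with blue⇒non-extreme x x-blue
... | x≢⊥ , x≢⊤ = ≤∧≢⇒< z≤n (λ 0≡∣x∣ → x≢⊥ (∣p∣≡0⇒p≡⊥ x (sym 0≡∣x∣)))
                , ≤∧≢⇒< (∣p∣≤n x) (λ ∣x∣≡N → x≢⊤ (∣p∣≡n⇒p≡⊤ ∣x∣≡N))

no-blue-copy : N < n + 2 → ¬ MonoCopy (extremes-red {N}) blue n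
no-blue-copy {N = N} {n = n} N<n+2 (q , mono) = <⇒≱ N<n+2 (begin
  n + 2                ≡⟨ +-comm n 2 ⟩
  suc (1 + n)          ≤⟨ s≤s (+-monoˡ-≤ n (proj₁ (bounds ⊥))) ⟩
  suc (∣ emb ⊥ ∣ + n)  ≤⟨ s≤s (rank-gap q) ⟩
  suc ∣ emb ⊤ ∣        ≤⟨ proj₂ (bounds ⊤) ⟩
  N                    ∎)
  where
    open ≤-Reasoning
    open QnCopy q
    bounds : ∀ x → 0 < ∣ emb x ∣ × ∣ emb x ∣ < N
    bounds x = blue⇒0<∣x∣<N (emb x) (mono x)

lower-bound : 2 ≤ n → N < n + 2 → ¬ RamseyProp n N
lower-bound {n = suc (suc n)} (s≤s (s≤s _)) N<n+2 ramsey with ramsey extremes-red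
... | inj₁ P                = no-two-coloured-antichain P
... | inj₂ (inj₁ blue-copy) = no-blue-copy N<n+2 blue-copy
... | inj₂ (inj₂ red-copy)  = no-red-copy red-copy

-- Upper bound

Bichromatic : Coloring N → Set
Bichromatic c = ∃₂ λ u v → Incomparable u v × c u ≡ blue × c v ≡ red

orient : ∀ {c : Coloring N} {u v} → Incomparable u v → c u ≢ c v → Bichromatic c
orient {c = c} {u} {v} u∥v cu≢cv with c u in cu | c v in cv
... | blue | red  = u , v , u∥v , cu , cv
... | red  | blue = v , u , swap u∥v , cv , cu
... | blue | blue = contradiction refl cu≢cv
... | red  | red  = contradiction refl cu≢cv

bichromatic-via : ∀ {c : Coloring N} {x y z} → Incomparable z x → Incomparable z y → c x ≢ c y → Bichromatic c
bichromatic-via {c = c} {x} {y} {z} z∥x z∥y cx≢cy with c z ≟ᶜ c x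
... | yes cz≡cx = orient z∥y (λ cz≡cy → cx≢cy (trans (sym cz≡cx) cz≡cy))
... | no  cz≢cx = orient z∥x cz≢cx

module UpperBound (m : ℕ) where

  Mixed : Subset (3 + m) → Set
  Mixed (true  ∷ true  ∷ true  ∷ _) = Empty
  Mixed (false ∷ false ∷ false ∷ _) = Empty
  Mixed _                           = Unit

  Mixed? : Decidable Mixed
  Mixed? (true  ∷ true  ∷ true  ∷ _) = no λ ()
  Mixed? (false ∷ false ∷ false ∷ _) = no λ ()
  Mixed? (true  ∷ true  ∷ false ∷ _) = yes _
  Mixed? (true  ∷ false ∷ _)         = yes _
  Mixed? (false ∷ true  ∷ _)         = yes _
  Mixed? (false ∷ false ∷ true  ∷ _) = yes _

  e₀ e₁ e₂ ē₀ ē₁ ē₂ : Subset (3 + m)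
  e₀ = true  ∷ false ∷ false ∷ ⊥
  e₁ = false ∷ true  ∷ false ∷ ⊥
  e₂ = false ∷ false ∷ true  ∷ ⊥
  ē₀ = false ∷ true  ∷ true  ∷ ⊤
  ē₁ = true  ∷ false ∷ true  ∷ ⊤
  ē₂ = true  ∷ true  ∷ false ∷ ⊤

  record Partners (y : Subset (3 + m)) : Set where
    constructor partners-of
    field
      z₁ z₂  : Subset (3 + m)
      mixed₁ : Mixed z₁
      mixed₂ : Mixed z₂
      y∥z₁   : Incomparable y z₁
      y∥z₂   : Incomparable y z₂
      z₁∥z₂  : Incomparable z₁ z₂

  partners : ∀ y → Mixed y → Partners y
  partners (true ∷ false ∷ false ∷ r) _ =
    partners-of (false ∷ true ∷ false ∷ r) (false ∷ false ∷ true ∷ r) _ _ decide-∥ decide-∥ decide-∥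
  partners (false ∷ true ∷ false ∷ r) _ =
    partners-of (false ∷ false ∷ true ∷ r) (true ∷ false ∷ false ∷ r) _ _ decide-∥ decide-∥ decide-∥
  partners (false ∷ false ∷ true ∷ r) _ =
    partners-of (true ∷ false ∷ false ∷ r) (false ∷ true ∷ false ∷ r) _ _ decide-∥ decide-∥ decide-∥
  partners (false ∷ true ∷ true ∷ r) _ =
    partners-of (true ∷ false ∷ true ∷ r) (true ∷ true ∷ false ∷ r) _ _ decide-∥ decide-∥ decide-∥
  partners (true ∷ false ∷ true ∷ r) _ =
    partners-of (true ∷ true ∷ false ∷ r) (false ∷ true ∷ true ∷ r) _ _ decide-∥ decide-∥ decide-∥
  partners (true ∷ true ∷ false ∷ r) _ =
    partners-of (false ∷ true ∷ true ∷ r) (true ∷ false ∷ true ∷ r) _ _ decide-∥ decide-∥ decide-∥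

  mixed-bichromatic : ∀ {c : Coloring (3 + m)} {x} → Mixed x → c x ≢ c e₀ → Bichromatic c
  mixed-bichromatic {x = false ∷ true  ∷ _}         _ ≢ = orient decide-∥ ≢
  mixed-bichromatic {x = false ∷ false ∷ true ∷ _}  _ ≢ = orient decide-∥ ≢
  mixed-bichromatic {x = true  ∷ false ∷ _}         _ ≢ = bichromatic-via {z = e₁} decide-∥ decide-∥ ≢
  mixed-bichromatic {x = true  ∷ true  ∷ false ∷ _} _ ≢ = bichromatic-via {z = e₂} decide-∥ decide-∥ ≢

  bichromatic-layers : ∀ {c : Coloring (5 + m)} →
                       Bichromatic (c ∘ (true ∷_) ∘ (false ∷_)) → Bichromatic (c ∘ (false ∷_) ∘ (true ∷_)) →
                       A2bA2rCopy c
  bichromatic-layers (u , v , u∥v , cu , cv) (u′ , v′ , u′∥v′ , cu′ , cv′) = record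
    { b₁ = true ∷ false ∷ u ; b₂ = false ∷ true ∷ u′ ; r₁ = true ∷ false ∷ v ; r₂ = false ∷ true ∷ v′
    ; inc-b₁b₂ = decide-∥ ; inc-r₁r₂ = decide-∥
    ; inc-b₁r₁ = ∷∷-∥ u∥v ; inc-b₁r₂ = decide-∥ ; inc-b₂r₁ = decide-∥ ; inc-b₂r₂ = ∷∷-∥ u′∥v′
    ; col-b₁ = cu ; col-b₂ = cu′ ; col-r₁ = cv ; col-r₂ = cv′
    }

  MonoOnMixed : Coloring (5 + m) → Bool → Bool → Color → Set
  MonoOnMixed c a b k = ∀ x → Mixed x → c (a ∷ b ∷ x) ≡ k

  module _ {c : Coloring (5 + m)} (k : Color) {a b : Bool} where

    partners-antichain : ∀ {y} (P : Partners y) → let open Partners P in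
                         c (a ∷ b ∷ z₁) ≡ k → c (a ∷ b ∷ z₂) ≡ k →
                         ∀ {p q} → c p ≡ opposite k → c q ≡ opposite k → Incomparable p q →
                         (∀ {z} → Incomparable y z → Incomparable p (a ∷ b ∷ z)) →
                         (∀ {z} → Incomparable y z → Incomparable q (a ∷ b ∷ z)) →
                         A2bA2rCopy c
    partners-antichain P cz₁ cz₂ cp cq p∥q p∥ q∥ =
      two-coloured-antichain k cp cq cz₁ cz₂ p∥q (∷∷-∥ z₁∥z₂) (p∥ y∥z₁) (p∥ y∥z₂) (q∥ y∥z₁) (q∥ y∥z₂)
      where open Partners P

    mono-partners-antichain : ∀ {y} → MonoOnMixed c a b k → Mixed y →
                              ∀ {p q} → c p ≡ opposite k → c q ≡ opposite k → Incomparable p q →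
                              (∀ {z} → Incomparable y z → Incomparable p (a ∷ b ∷ z)) →
                              (∀ {z} → Incomparable y z → Incomparable q (a ∷ b ∷ z)) →
                              A2bA2rCopy c
    mono-partners-antichain mono my = partners-antichain P (mono _ mixed₁) (mono _ mixed₂)
      where P = partners _ my
            open Partners P

  -- x₀ ∷ x₁ ∷ x ↦ x₀ ∷ x₁ ∷ true ∷ false ∷ x
  diagonal : QnCopy (3 + m) (5 + m)
  diagonal = on-tail (on-tail (prepend true ∘ᶜ prepend false))

  module MonoOnMixed₁₀ (c : Coloring (5 + m)) (k : Color) (mono₁₀ : MonoOnMixed c true false k) where

    private
      k̄ : Color
      k̄ = opposite k

      -- Coordinate 2 of the subsets compared below is unknown, so non-inclusion is decided past it.
      decide-⊈₃ : ∀ {a b c a′ b′ c′} {x y : Subset (2 + m)} {x⊈y : False (x ⊆? y)} →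
                  ¬ (a ∷ b ∷ c ∷ x) ⊆ (a′ ∷ b′ ∷ c′ ∷ y)
      decide-⊈₃ {x⊈y = x⊈y} = ∷⊈∷ (∷⊈∷ (∷⊈∷ (toWitnessFalse x⊈y)))

    opposite-pair₀₁ : ∀ {y z} → c (false ∷ true ∷ y) ≡ k̄ → c (false ∷ true ∷ z) ≡ k̄ → Incomparable y z →
                      A2bA2rCopy c
    opposite-pair₀₁ cy cz y∥z = two-coloured-antichain k cy cz (mono₁₀ e₀ _) (mono₁₀ e₁ _)
      (∷∷-∥ y∥z) decide-∥ decide-∥ decide-∥ decide-∥ decide-∥

    mixed-defect₀₁ : ∀ {w y} → c (true ∷ false ∷ w) ≡ k̄ → Mixed y → c (false ∷ true ∷ y) ≡ k̄ → A2bA2rCopy c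
    mixed-defect₀₁ {y = y} cw my cy with partners y my
    ... | P@(partners-of z₁ z₂ _ _ y∥z₁ y∥z₂ _)
      with c (false ∷ true ∷ z₁) ≟ᶜ k | c (false ∷ true ∷ z₂) ≟ᶜ k
    ...   | yes cz₁ | yes cz₂ = partners-antichain k P cz₁ cz₂ cw cy decide-∥ (λ _ → decide-∥) ∷∷-∥
    ...   | no  cz₁ | _       = opposite-pair₀₁ cy (≢⇒≡opposite cz₁) y∥z₁
    ...   | yes _   | no  cz₂ = opposite-pair₀₁ cy (≢⇒≡opposite cz₂) y∥z₂

    module _ (mono₀₁ : MonoOnMixed c false true k) where

      defect₀₀ : ∀ {t w v} → c (true ∷ false ∷ w) ≡ k̄ → c (false ∷ true ∷ v) ≡ k̄ →
                 c (false ∷ false ∷ true ∷ false ∷ t) ≡ k̄ → A2bA2rCopy c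
      defect₀₀ {w = false ∷ _} cw _ cd =
        mono-partners-antichain k mono₀₁ _ cd cw decide-∥ ∷∷-∥ (λ _ → decide-∥)
      defect₀₀ {w = true ∷ _} {false ∷ _} _ cv cd =
        mono-partners-antichain k mono₁₀ _ cd cv decide-∥ ∷∷-∥ (λ _ → decide-∥)
      defect₀₀ {w = true ∷ _} {true ∷ _} cw cv _
        with c (true ∷ true ∷ e₁) ≟ᶜ k | c (true ∷ true ∷ e₂) ≟ᶜ k
      ... | yes c₁ | yes c₂ = two-coloured-antichain k cw cv c₁ c₂
                                decide-∥ decide-∥ decide-∥ decide-∥ decide-∥ decide-∥
      ... | no  c₁ | _      = two-coloured-antichain k (≢⇒≡opposite c₁) cw (mono₀₁ e₀ _) (mono₀₁ e₂ _)
                                decide-∥ decide-∥ decide-∥ decide-∥ decide-∥ decide-∥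
      ... | yes _  | no c₂  = two-coloured-antichain k (≢⇒≡opposite c₂) cw (mono₀₁ e₀ _) (mono₀₁ e₁ _)
                                decide-∥ decide-∥ decide-∥ decide-∥ decide-∥ decide-∥

      defect₁₁ : ∀ {t w v} → c (true ∷ false ∷ w) ≡ k̄ → c (false ∷ true ∷ v) ≡ k̄ →
                 c (true ∷ true ∷ true ∷ false ∷ t) ≡ k̄ → A2bA2rCopy c
      defect₁₁ {w = _ ∷ true ∷ _} cw _ cd =
        mono-partners-antichain k mono₀₁ _ cd cw (decide-⊈ , decide-⊈₃) ∷∷-∥ (λ _ → decide-∥)
      defect₁₁ {w = _ ∷ false ∷ _} {_ ∷ true ∷ _} _ cv cd =
        mono-partners-antichain k mono₁₀ _ cd cv (decide-⊈ , decide-⊈₃) ∷∷-∥ (λ _ → decide-∥)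
      defect₁₁ {w = _ ∷ false ∷ _} {_ ∷ false ∷ _} cw cv _
        with c (false ∷ false ∷ ē₀) ≟ᶜ k | c (false ∷ false ∷ ē₂) ≟ᶜ k
      ... | yes c₀ | yes c₂ = two-coloured-antichain k cw cv c₀ c₂
                                decide-∥ decide-∥ decide-∥ (decide-⊈ , decide-⊈₃)
                                decide-∥ (decide-⊈ , decide-⊈₃)
      ... | no  c₀ | _      = two-coloured-antichain k (≢⇒≡opposite c₀) cw (mono₀₁ ē₁ _) (mono₀₁ ē₂ _)
                                decide-∥ decide-∥ decide-∥ decide-∥ decide-∥ decide-∥
      ... | yes _  | no c₂  = two-coloured-antichain k (≢⇒≡opposite c₂) cw (mono₀₁ ē₀ _) (mono₀₁ ē₁ _)
                                (decide-⊈₃ , decide-⊈) decide-∥ decide-∥ decide-∥ decide-∥ decide-∥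

      mono₀₁-witness : ∀ {w v} → c (true ∷ false ∷ w) ≡ k̄ → c (false ∷ true ∷ v) ≡ k̄ →
                       RamseyWitness c (3 + m)
      mono₀₁-witness cw cv with all-or-counterexample (λ t →
        (c (false ∷ false ∷ true ∷ false ∷ t) ≟ᶜ k) ×-dec (c (true ∷ true ∷ true ∷ false ∷ t) ≟ᶜ k))
      ... | inj₁ corners = mono-witness k (diagonal , diagonal-mono)
        where
          diagonal-mono : ∀ x → c (QnCopy.emb diagonal x) ≡ k
          diagonal-mono (true  ∷ false ∷ t) = mono₁₀ (true ∷ false ∷ t) _
          diagonal-mono (false ∷ true  ∷ t) = mono₀₁ (true ∷ false ∷ t) _
          diagonal-mono (false ∷ false ∷ t) = proj₁ (corners t)
          diagonal-mono (true  ∷ true  ∷ t) = proj₂ (corners t)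
      ... | inj₂ (t , ¬corners) with c (false ∷ false ∷ true ∷ false ∷ t) ≟ᶜ k
      ...   | no  c₀₀ = inj₁ (defect₀₀ cw cv (≢⇒≡opposite c₀₀))
      ...   | yes c₀₀ = inj₁ (defect₁₁ cw cv (≢⇒≡opposite λ c₁₁ → ¬corners (c₀₀ , c₁₁)))

    witness : RamseyWitness c (3 + m)
    witness with all-or-counterexample (λ w → c (true ∷ false ∷ w) ≟ᶜ k)
    ... | inj₁ mono = mono-witness k (layer true false , mono)
    ... | inj₂ (w , cw) with all-or-counterexample (λ v → c (false ∷ true ∷ v) ≟ᶜ k)
    ...   | inj₁ mono = mono-witness k (layer false true , mono)
    ...   | inj₂ (v , cv) with all-or-counterexample-in Mixed? (λ y → c (false ∷ true ∷ y) ≟ᶜ k)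
    ...     | inj₂ (y , my , cy) = inj₁ (mixed-defect₀₁ (≢⇒≡opposite cw) my (≢⇒≡opposite cy))
    ...     | inj₁ mono₀₁        = mono₀₁-witness mono₀₁ (≢⇒≡opposite cw) (≢⇒≡opposite cv)

  upper-bound : RamseyProp (3 + m) (5 + m)
  upper-bound c
    with all-or-counterexample-in Mixed? (λ x → c (true ∷ false ∷ x) ≟ᶜ c (true ∷ false ∷ e₀))
  ... | inj₁ mono₁₀ = MonoOnMixed₁₀.witness c _ mono₁₀
  ... | inj₂ (x , mx , cx≢)
    with all-or-counterexample-in Mixed? (λ x → c (false ∷ true ∷ x) ≟ᶜ c (false ∷ true ∷ e₀))
  ...   | inj₁ mono₀₁ = pull-back exchange-copy (MonoOnMixed₁₀.witness (c ∘ exchange) _ mono₀₁)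
  ...   | inj₂ (x′ , mx′ , cx′≢) =
    inj₁ (bichromatic-layers (mixed-bichromatic mx cx≢) (mixed-bichromatic mx′ cx′≢))

lemma4 : ∀ (n : ℕ) → 3 ≤ n → RtildeEq n (n + 2)
lemma4 (suc (suc (suc m))) (s≤s (s≤s (s≤s _))) =
  subst (RamseyProp (3 + m)) (+-comm 2 (3 + m)) (UpperBound.upper-bound m) ,
  λ _ → lower-bound (s≤s (s≤s z≤n))
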